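{- For any graphs $G$ and $H$, $$\gamma^{p}_{I}(G\,\square\, H)\le \min\{|V(H)|\,\gamma^{p}_{I}(G),\ |V(G)|\,\gamma^{p}_{I}(H)\}.$$
   Context: All graphs are finite and simple with nonempty vertex sets. A perfect Italian dominating function (PID-function) of a graph $G$ is a function $f:V(G)\to\{0,1,2\}$ such that for every vertex $v$ with $f(v)=0$ we have $\sum_{u\in N(v)}f(u)=2$, where $N(v)$ is the open neighborhood of $v$. Its weight is $\sum_{u\in V(G)}f(u)$. The perfect Italian domination number $\gamma^{p}_{I}(G)$ is the minimum weight of a PID-function of $G$. The Cartesian product $G\square H$ has vertex set $V(G)\times V(H)$, with $(u_1,v_1)$ adjacent to $(u_2,v_2)$ iff either $u_1=u_2$ and $v_1v_2\in E(H)$, or $v_1=v_2$ and $u_1u_2\in E(G)$. -}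

module Defs where

open import Data.Nat using (ℕ; zero; suc; _+_; _*_; _≤_)
open import Data.Fin using (Fin; toℕ; remQuot)
open import Data.Fin.Properties using (_≟_)
open import Data.Bool using (Bool; true; false; if_then_else_; _∧_; _∨_)
open import Data.Product using (Σ; _×_; _,_; proj₁; proj₂)
open import Relation.Nullary.Decidable using (⌊_⌋)
open import Relation.Binary.PropositionalEquality using (_≡_)

record Graph : Set where
  constructor mkGraph
  field
    order : ℕ
    adj   : Fin order → Fin order → Bool
open Graph public

record Simple (G : Graph) : Set where
  field
    nonempty : 1 ≤ order G
    symm     : ∀ u v → adj G u v ≡ adj G v u
    irrefl   : ∀ v → adj G v v ≡ false

sumFin : ∀ {n} → (Fin n → ℕ) → ℕ
sumFin {zero}  f = 0
sumFin {suc n} f = f Fin.zero + sumFin (λ i → f (Fin.suc i))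

∣V∣ : Graph → ℕ
∣V∣ = order

weight : (G : Graph) → (Fin (order G) → Fin 3) → ℕ
weight G f = sumFin (λ v → toℕ (f v))

nbSum : (G : Graph) → (Fin (order G) → Fin 3) → Fin (order G) → ℕ
nbSum G f v = sumFin (λ u → if adj G v u then toℕ (f u) else 0)

IsPIDF : (G : Graph) → (Fin (order G) → Fin 3) → Set
IsPIDF G f = ∀ v → toℕ (f v) ≡ 0 → nbSum G f v ≡ 2

IsPIDNumber : Graph → ℕ → Set
IsPIDNumber G k =
  Σ (Fin (order G) → Fin 3) (λ f → IsPIDF G f × weight G f ≡ k)
  × (∀ f → IsPIDF G f → k ≤ weight G f)

-- Cartesian product G □ H, vertex (u , v) encoded as Fin (|V G| * |V H|) via remQuot
_□_ : Graph → Graph → Graph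
G □ H = mkGraph (order G * order H) a
  where
  a : Fin (order G * order H) → Fin (order G * order H) → Bool
  a x y with remQuot (order H) x | remQuot (order H) y
  ... | (u₁ , v₁) | (u₂ , v₂) =
    (⌊ u₁ ≟ u₂ ⌋ ∧ adj H v₁ v₂) ∨ (⌊ v₁ ≟ v₂ ⌋ ∧ adj G u₁ u₂)

-- A PID-function f of G lifts to G □ H by (u , v) ↦ f u. The
-- open neighbourhood of (u , v) in G □ H is the disjoint union of
-- {u} × N_H(v) and N_G(u) × {v} (disjoint because G has no loops), so the
-- neighbourhood sum of the lift at (u , v) is deg_H(v)·f(u) plus the
-- neighbourhood sum of f at u in G. When the lift vanishes at (u , v) we
-- have f(u) = 0, so this is 2: the lift is a PID-function, and its weight is
-- |V(H)|·w(f). Symmetrically for H. Minimality of γᵖᴵ(G □ H) then gives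
-- both bounds.
module Submission where

open import Defs
open import Data.Nat using (ℕ; zero; suc; _+_; _*_; _≤_; _⊓_)
open import Data.Nat.Properties using (+-assoc; +-commutativeSemigroup; +-identityʳ; *-zeroʳ; *-distribˡ-+; ⊓-glb)
open import Data.Fin using (Fin; toℕ; remQuot; combine; _↑ˡ_; _↑ʳ_)
open import Data.Fin.Properties using (_≟_; remQuot-combine)
open import Data.Bool.Properties using (∧-zeroʳ)
open import Data.Bool using (Bool; true; false; if_then_else_; _∧_; _∨_)
open import Data.Product using (_,_; proj₁; proj₂)
open import Relation.Nullary using (yes; no)
open import Relation.Nullary.Decidable using (⌊_⌋)
open import Algebra.Properties.CommutativeSemigroup +-commutativeSemigroup
  using () renaming (interchange to +-interchange)
open import Relation.Binary.PropositionalEquality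
  using (_≡_; refl; sym; trans; cong; cong₂; module ≡-Reasoning)

open ≡-Reasoning

sumFin-cong : ∀ {n} {f g : Fin n → ℕ} → (∀ i → f i ≡ g i) → sumFin f ≡ sumFin g
sumFin-cong {zero}  e = refl
sumFin-cong {suc n} e = cong₂ _+_ (e Fin.zero) (sumFin-cong (λ i → e (Fin.suc i)))

sumFin-zero : ∀ n → sumFin {n} (λ _ → 0) ≡ 0
sumFin-zero zero    = refl
sumFin-zero (suc n) = sumFin-zero n

sumFin-const : ∀ n c → sumFin {n} (λ _ → c) ≡ n * c
sumFin-const zero    c = refl
sumFin-const (suc n) c = cong (c +_) (sumFin-const n c)

sumFin-scale : ∀ {n} c (f : Fin n → ℕ) → sumFin (λ i → c * f i) ≡ c * sumFin f
sumFin-scale {zero}  c f = sym (*-zeroʳ c)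
sumFin-scale {suc n} c f = begin
  c * f Fin.zero + sumFin (λ i → c * f (Fin.suc i))
    ≡⟨ cong (c * f Fin.zero +_) (sumFin-scale c (λ i → f (Fin.suc i))) ⟩
  c * f Fin.zero + c * sumFin (λ i → f (Fin.suc i))
    ≡⟨ sym (*-distribˡ-+ c (f Fin.zero) _) ⟩
  c * sumFin f ∎

sumFin-+ : ∀ {n} (f g : Fin n → ℕ) →
  sumFin (λ i → f i + g i) ≡ sumFin f + sumFin g
sumFin-+ {zero}  f g = refl
sumFin-+ {suc n} f g =
  trans (cong (f Fin.zero + g Fin.zero +_) (sumFin-+ (λ i → f (Fin.suc i)) (λ i → g (Fin.suc i))))
        (+-interchange (f Fin.zero) (g Fin.zero) _ _)

sumFin-↑ : ∀ a b (φ : Fin (a + b) → ℕ) →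
  sumFin φ ≡ sumFin (λ i → φ (i ↑ˡ b)) + sumFin (λ j → φ (a ↑ʳ j))
sumFin-↑ zero    b φ = refl
sumFin-↑ (suc a) b φ =
  trans (cong (φ Fin.zero +_) (sumFin-↑ a b (λ i → φ (Fin.suc i))))
        (sym (+-assoc (φ Fin.zero) _ _))

sumFin-combine : ∀ m n (φ : Fin (m * n) → ℕ) →
  sumFin φ ≡ sumFin (λ u → sumFin (λ v → φ (combine {m} {n} u v)))
sumFin-combine zero    n φ = refl
sumFin-combine (suc m) n φ =
  trans (sumFin-↑ n (m * n) φ)
        (cong (sumFin (λ v → φ (v ↑ˡ (m * n))) +_) (sumFin-combine m n (λ j → φ (n ↑ʳ j))))

sumFin-remQuot : ∀ m n (h : Fin m → Fin n → ℕ) →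
  sumFin (λ x → h (proj₁ (remQuot {m} n x)) (proj₂ (remQuot {m} n x)))
    ≡ sumFin (λ u → sumFin (λ v → h u v))
sumFin-remQuot m n h = trans (sumFin-combine m n _)
  (sumFin-cong (λ u → sumFin-cong (λ v →
    cong (λ p → h (proj₁ p) (proj₂ p)) (remQuot-combine u v))))

sumFin-delta : ∀ {n} (a : Fin n) (c : Fin n → ℕ) →
  sumFin (λ w → if ⌊ a ≟ w ⌋ then c w else 0) ≡ c a
sumFin-delta {suc n} Fin.zero c =
  trans (cong (c Fin.zero +_) (sumFin-zero n)) (+-identityʳ _)
sumFin-delta {suc n} (Fin.suc a) c =
  trans (sumFin-cong shift) (sumFin-delta a (λ w → c (Fin.suc w)))
  where
  shift : ∀ w → (if ⌊ Fin.suc a ≟ Fin.suc w ⌋ then c (Fin.suc w) else 0)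
              ≡ (if ⌊ a ≟ w ⌋ then c (Fin.suc w) else 0)
  shift w with a ≟ w
  ... | yes _ = refl
  ... | no  _ = refl

sumFin-if : ∀ {n} (b : Bool) (f : Fin n → ℕ) →
  sumFin (λ i → if b then f i else 0) ≡ (if b then sumFin f else 0)
sumFin-if {n} true  f = refl
sumFin-if {n} false f = sumFin-zero n

if-∨ : ∀ a b c → a ∧ b ≡ false →
  (if a ∨ b then c else 0) ≡ (if a then c else 0) + (if b then c else 0)
if-∨ true  true  c ()
if-∨ true  false c _ = sym (+-identityʳ c)
if-∨ false b     c _ = refl

if-∧ : ∀ a b c → (if a ∧ b then c else 0) ≡ (if a then (if b then c else 0) else 0)
if-∧ true  b c = refl
if-∧ false b c = refl

-- A neighbourhood-style sum of the zero function is 0 whatever the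
-- adjacency; it kills the fibre along which a lifted function is constant 0.
sumFin-if-zero : ∀ {n} (p : Fin n → Bool) →
  sumFin (λ i → if p i then 0 else 0) ≡ 0
sumFin-if-zero {n} p = trans (sumFin-cong (λ i → zero-branch (p i))) (sumFin-zero n)
  where
  zero-branch : ∀ b → (if b then 0 else 0) ≡ 0
  zero-branch true  = refl
  zero-branch false = refl

module Product (G H : Graph) where

  π₁ : Fin (order (G □ H)) → Fin (order G)
  π₁ x = proj₁ (remQuot {order G} (order H) x)

  π₂ : Fin (order (G □ H)) → Fin (order H)
  π₂ x = proj₂ (remQuot {order G} (order H) x)

  lift : (Fin (order G) → Fin (order H) → Fin 3) → Fin (order (G □ H)) → Fin 3
  lift h x = h (π₁ x) (π₂ x)

  weight-□ : ∀ h → weight (G □ H) (lift h)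
                    ≡ sumFin (λ u → sumFin (λ v → toℕ (h u v)))
  weight-□ h = sumFin-remQuot (order G) (order H) (λ u v → toℕ (h u v))

  weight-liftG : ∀ f → weight (G □ H) (lift (λ u _ → f u)) ≡ order H * weight G f
  weight-liftG f = begin
    weight (G □ H) (lift (λ u _ → f u))
      ≡⟨ weight-□ (λ u _ → f u) ⟩
    sumFin (λ u → sumFin {order H} (λ _ → toℕ (f u)))
      ≡⟨ sumFin-cong (λ u → sumFin-const (order H) (toℕ (f u))) ⟩
    sumFin (λ u → order H * toℕ (f u))
      ≡⟨ sumFin-scale (order H) (λ u → toℕ (f u)) ⟩
    order H * weight G f ∎

  weight-liftH : ∀ g → weight (G □ H) (lift (λ _ v → g v)) ≡ order G * weight H g
  weight-liftH g = trans (weight-□ (λ _ v → g v)) (sumFin-const (order G) (weight H g))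

  module _ (loopless : ∀ u → adj G u u ≡ false) where

    -- No vertex is both a G-fibre neighbour and an H-fibre neighbour,
    -- since that would require a loop of G.
    fibres-disjoint : ∀ u v u′ v′ →
      (⌊ u ≟ u′ ⌋ ∧ adj H v v′) ∧ (⌊ v ≟ v′ ⌋ ∧ adj G u u′) ≡ false
    fibres-disjoint u v u′ v′ with u ≟ u′
    ... | no  _ = refl
    ... | yes refl rewrite loopless u | ∧-zeroʳ ⌊ v ≟ v′ ⌋ = ∧-zeroʳ (adj H v v′)

    nbSum-□ : ∀ h x →
      nbSum (G □ H) (lift h) x
        ≡ sumFin (λ v′ → if adj H (π₂ x) v′ then toℕ (h (π₁ x) v′) else 0)
          + sumFin (λ u′ → if adj G (π₁ x) u′ then toℕ (h u′ (π₂ x)) else 0)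
    nbSum-□ h x = begin
      nbSum (G □ H) (lift h) x
        ≡⟨ sumFin-remQuot (order G) (order H) _ ⟩
      sumFin (λ u′ → sumFin (λ v′ →
        if (⌊ u ≟ u′ ⌋ ∧ adj H v v′) ∨ (⌊ v ≟ v′ ⌋ ∧ adj G u u′) then toℕ (h u′ v′) else 0))
        ≡⟨ sumFin-cong (λ u′ → sumFin-cong (λ v′ →
             if-∨ (⌊ u ≟ u′ ⌋ ∧ adj H v v′) (⌊ v ≟ v′ ⌋ ∧ adj G u u′) (toℕ (h u′ v′))
                  (fibres-disjoint u v u′ v′))) ⟩
      sumFin (λ u′ → sumFin (λ v′ → vert u′ v′ + horiz u′ v′))
        ≡⟨ sumFin-cong (λ u′ → sumFin-+ (vert u′) (horiz u′)) ⟩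
      sumFin (λ u′ → sumFin (vert u′) + sumFin (horiz u′))
        ≡⟨ sumFin-+ (λ u′ → sumFin (vert u′)) (λ u′ → sumFin (horiz u′)) ⟩
      sumFin (λ u′ → sumFin (vert u′)) + sumFin (λ u′ → sumFin (horiz u′))
        ≡⟨ cong₂ _+_ vertical-fibre horizontal-fibre ⟩
      sumFin (inH u) + sumFin (λ u′ → inG u′ v) ∎
      where
      u = π₁ x
      v = π₂ x
      inH inG : Fin (order G) → Fin (order H) → ℕ
      inH u′ v′ = if adj H v v′ then toℕ (h u′ v′) else 0
      inG u′ v′ = if adj G u u′ then toℕ (h u′ v′) else 0
      vert horiz : Fin (order G) → Fin (order H) → ℕ
      vert  u′ v′ = if ⌊ u ≟ u′ ⌋ ∧ adj H v v′ then toℕ (h u′ v′) else 0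
      horiz u′ v′ = if ⌊ v ≟ v′ ⌋ ∧ adj G u u′ then toℕ (h u′ v′) else 0

      vertical-fibre : sumFin (λ u′ → sumFin (vert u′)) ≡ sumFin (inH u)
      vertical-fibre = begin
        sumFin (λ u′ → sumFin (vert u′))
          ≡⟨ sumFin-cong (λ u′ → sumFin-cong (λ v′ → if-∧ ⌊ u ≟ u′ ⌋ (adj H v v′) (toℕ (h u′ v′)))) ⟩
        sumFin (λ u′ → sumFin (λ v′ → if ⌊ u ≟ u′ ⌋ then inH u′ v′ else 0))
          ≡⟨ sumFin-cong (λ u′ → sumFin-if ⌊ u ≟ u′ ⌋ (inH u′)) ⟩
        sumFin (λ u′ → if ⌊ u ≟ u′ ⌋ then sumFin (inH u′) else 0)
          ≡⟨ sumFin-delta u (λ u′ → sumFin (inH u′)) ⟩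
        sumFin (inH u) ∎

      horizontal-fibre : sumFin (λ u′ → sumFin (horiz u′)) ≡ sumFin (λ u′ → inG u′ v)
      horizontal-fibre = sumFin-cong (λ u′ →
        trans (sumFin-cong (λ v′ → if-∧ ⌊ v ≟ v′ ⌋ (adj G u u′) (toℕ (h u′ v′)))) (sumFin-delta v (inG u′)))

    -- The lift of a PID-function of G is a PID-function of G □ H: at a zero
    -- (u , v) the H-fibre contributes deg_H(v)·f(u) = 0 and the G-fibre 2.
    liftG-PIDF : ∀ f → IsPIDF G f → IsPIDF (G □ H) (lift (λ u _ → f u))
    liftG-PIDF f pid x fu≡0 = begin
      nbSum (G □ H) (lift (λ u _ → f u)) x
        ≡⟨ nbSum-□ (λ u _ → f u) x ⟩
      sumFin (λ v′ → if adj H (π₂ x) v′ then toℕ (f (π₁ x)) else 0) + nbSum G f (π₁ x)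
        ≡⟨ cong₂ _+_ H-fibre (pid (π₁ x) fu≡0) ⟩
      2 ∎
      where
      H-fibre : sumFin (λ v′ → if adj H (π₂ x) v′ then toℕ (f (π₁ x)) else 0) ≡ 0
      H-fibre = trans (cong (λ n → sumFin (λ v′ → if adj H (π₂ x) v′ then n else 0)) fu≡0)
                      (sumFin-if-zero (adj H (π₂ x)))

    liftH-PIDF : ∀ g → IsPIDF H g → IsPIDF (G □ H) (lift (λ _ v → g v))
    liftH-PIDF g pid x gv≡0 = begin
      nbSum (G □ H) (lift (λ _ v → g v)) x
        ≡⟨ nbSum-□ (λ _ v → g v) x ⟩
      nbSum H g (π₂ x) + sumFin (λ u′ → if adj G (π₁ x) u′ then toℕ (g (π₂ x)) else 0)
        ≡⟨ cong₂ _+_ (pid (π₂ x) gv≡0) G-fibre ⟩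
      2 ∎
      where
      G-fibre : sumFin (λ u′ → if adj G (π₁ x) u′ then toℕ (g (π₂ x)) else 0) ≡ 0
      G-fibre = trans (cong (λ n → sumFin (λ u′ → if adj G (π₁ x) u′ then n else 0)) gv≡0)
                      (sumFin-if-zero (adj G (π₁ x)))

PIDNumber-≤ : ∀ {Γ k w} F → IsPIDNumber Γ k → IsPIDF Γ F → weight Γ F ≡ w → k ≤ w
PIDNumber-≤ F (_ , minimal) pid refl = minimal F pid

theorem4p1 : (G H : Graph) → Simple G → Simple H →
    (kG kH k : ℕ) → IsPIDNumber G kG → IsPIDNumber H kH →
    IsPIDNumber (G □ H) k →
    k ≤ (∣V∣ H * kG) ⊓ (∣V∣ G * kH)
theorem4p1 G H sG _ kG kH k ((f , pid-f , wf) , _) ((g , pid-g , wg) , _) γ□ =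
  ⊓-glb
    (PIDNumber-≤ _ γ□ (liftG-PIDF (Simple.irrefl sG) f pid-f)
                      (trans (weight-liftG f) (cong (order H *_) wf)))
    (PIDNumber-≤ _ γ□ (liftH-PIDF (Simple.irrefl sG) g pid-g)
                      (trans (weight-liftH g) (cong (order G *_) wg)))
  where open Product G H
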